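{- Let $q$ be a power of an odd prime, $t$ a nonsquare in $\mathbb{F}_q$, and $d \geq 2$. Let $Q = \{(x,y,tx^2-y^2) : x,y \in \mathbb{F}_q\} \subset \mathbb{F}_q^3$. Define $P_d \subset \mathbb{F}_q^d$ as the Cartesian product of $\lfloor d/3 \rfloor$ copies of $Q$ together with an extra factor: no extra factor if $d \equiv 0 \pmod 3$; the factor $\{0\} \subset \mathbb{F}_q$ if $d \equiv 1 \pmod 3$; the factor $\{(x,tx^2) : x \in \mathbb{F}_q\} \subset \mathbb{F}_q^2$ if $d \equiv 2 \pmod 3$. Then $|P_d| = q^{\lfloor 2d/3 \rfloor}$, and no line in $\mathbb{F}_q^d$ contains three distinct points of $P_d$.
   Context: A line in $\mathbb{F}_q^d$ is a set $\{u + rv : r \in \mathbb{F}_q\}$ with $v \neq 0$. -}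

module Defs where

open import Data.Nat using (ℕ; zero; suc)
open import Data.Fin using (Fin)
open import Data.Vec using (Vec; []; _∷_; zipWith; map; replicate)
open import Data.Product using (∃; _×_)
open import Data.Unit using (⊤)
open import Relation.Nullary using (¬_)
open import Relation.Binary.PropositionalEquality using (_≡_)
open import Function.Bundles using (_↔_)
open import Algebra.Structures using (IsCommutativeRing)

record FiniteField (q : ℕ) : Set₁ where
  infixl 6 _+_
  infixl 7 _*_
  infix 8 -_
  field
    F      : Set
    _+_    : F → F → F
    _*_    : F → F → F
    -_     : F → F
    0#     : F
    1#     : F
    isCommutativeRing : IsCommutativeRing _≡_ _+_ _*_ -_ 0# 1#
    0≢1    : ¬ (0# ≡ 1#)
    inverse : ∀ x → ¬ (x ≡ 0#) → ∃ λ y → x * y ≡ 1#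
    enumeration : Fin q ↔ F

module _ {q : ℕ} (𝔽 : FiniteField q) where
  open FiniteField 𝔽

  IsNonsquare : F → Set
  IsNonsquare t = ∀ s → ¬ (s * s ≡ t)

  _⊕_ : ∀ {d} → Vec F d → Vec F d → Vec F d
  u ⊕ v = zipWith _+_ u v

  _⊙_ : ∀ {d} → F → Vec F d → Vec F d
  r ⊙ v = map (r *_) v

  zeroVec : ∀ d → Vec F d
  zeroVec d = replicate d 0#

  -- the line {u + r v : r ∈ F_q} (v ≠ 0 is imposed where lines are quantified)
  OnLine : ∀ {d} → Vec F d → Vec F d → Vec F d → Set
  OnLine u v a = ∃ λ r → a ≡ u ⊕ (r ⊙ v)

  InP : (t : F) → (d : ℕ) → Vec F d → Set
  InP t zero [] = ⊤
  InP t (suc zero) (x ∷ []) = x ≡ 0#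
  InP t (suc (suc zero)) (x ∷ y ∷ []) = y ≡ t * (x * x)
  InP t (suc (suc (suc d))) (x ∷ y ∷ z ∷ v) =
    (z ≡ t * (x * x) + - (y * y)) × InP t d v

module Submission where

-- A point of P_d is determined by its free coordinates: the pair
-- (x, y) of every Q-block and the x of the parabola factor.  So P_d is in
-- bijection with F^n for n = paramDim d, and paramDim d = ⌊2d/3⌋; finally
-- F^n has q^n elements because F has q.
--
-- Suppose u + r v lies in P_d for three distinct
-- values of r.  On each factor of the product the defining equation, restricted
-- to the line, says that two polynomials of degree at most 2 in r agree at three
-- distinct points; hence their r² and r coefficients coincide ("quadratic
-- rigidity").  For the block Q this gives v_y² = t v_x², which forces v_x = 0 as
-- t is a nonsquare, and then v_y = v_z = 0; the factors {0} and {(x, t x²)} are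
-- handled the same way.  Hence v = 0, so the line is degenerate.

open import Defs
open import Data.Nat using (ℕ; _≤_; _^_; _*_; _/_)
open import Data.Nat.Primality using (Prime)
open import Data.Fin using (Fin)
open import Data.Vec using (Vec)
open import Data.Product using (Σ; _×_)
open import Relation.Nullary using (¬_)
open import Relation.Binary.PropositionalEquality using (_≡_)
open import Function.Bundles using (_↔_)

open import Data.Nat using (zero; suc)
import Data.Nat as Nat
open import Data.Nat.Properties using (*-distribˡ-+)
open import Data.Nat.DivMod using (+-distrib-/-∣ˡ)
open import Data.Nat.Divisibility using (divides-refl)
import Data.Fin as Fin
open import Data.Fin.Properties using (*↔×)
open import Data.Vec using ([]; _∷_)
open import Data.Product using (_,_; proj₁; proj₂; ∃)
open import Data.Product.Function.NonDependent.Propositional using (_×-↔_)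
open import Data.Unit using (tt)
open import Data.Empty using (⊥-elim)
open import Function.Base using (_∘_)
open import Function.Bundles using (mk↔ₛ′)
open import Function.Properties.Inverse using (↔-sym; ↔-trans; ↔⇒↣)
open import Relation.Nullary using (yes; no)
open import Relation.Nullary.Decidable using (via-injection)
open import Relation.Binary.Definitions using (DecidableEquality)
open import Relation.Binary.PropositionalEquality
  using (_≢_; refl; sym; trans; cong; cong₂; module ≡-Reasoning)
open import Algebra.Bundles using (CommutativeRing)
import Algebra.Properties.Group as GroupProperties

-- The number of free coordinates of a point of P_d: two per Q-block, one for
-- the parabola factor {(x, t x²)}, none for the factor {0}.
paramDim : ℕ → ℕ
paramDim zero = 0
paramDim (suc zero) = 0
paramDim (suc (suc zero)) = 1
paramDim (suc (suc (suc d))) = 2 Nat.+ paramDim d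

⌊2d/3⌋≡paramDim : ∀ d → (2 * d) / 3 ≡ paramDim d
⌊2d/3⌋≡paramDim zero = refl
⌊2d/3⌋≡paramDim (suc zero) = refl
⌊2d/3⌋≡paramDim (suc (suc zero)) = refl
⌊2d/3⌋≡paramDim (suc (suc (suc d))) = begin
  (2 * (3 Nat.+ d)) / 3        ≡⟨ cong (_/ 3) (*-distribˡ-+ 2 3 d) ⟩
  (2 * 3 Nat.+ 2 * d) / 3      ≡⟨ +-distrib-/-∣ˡ {2 * 3} (2 * d) {3} (divides-refl 2) ⟩
  2 Nat.+ (2 * d) / 3          ≡⟨ cong (2 Nat.+_) (⌊2d/3⌋≡paramDim d) ⟩
  2 Nat.+ paramDim d           ∎
  where open ≡-Reasoning

×↔Vec-suc : ∀ {a} {A : Set a} {n} → (A × Vec A n) ↔ Vec A (suc n)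
×↔Vec-suc = mk↔ₛ′ (λ p → proj₁ p ∷ proj₂ p) (λ { (x ∷ xs) → x , xs })
                  (λ { (x ∷ xs) → refl }) (λ _ → refl)

Fin^↔Vec : ∀ {a} {A : Set a} {m} → Fin m ↔ A → ∀ n → Fin (m ^ n) ↔ Vec A n
Fin^↔Vec e zero = mk↔ₛ′ (λ _ → []) (λ _ → Fin.zero)
                        (λ { [] → refl }) (λ { Fin.zero → refl ; (Fin.suc ()) })
Fin^↔Vec {m = m} e (suc n) =
  ↔-trans (*↔× {m} {m ^ n}) (↔-trans (e ×-↔ Fin^↔Vec e n) ×↔Vec-suc)

module FieldFacts {q : ℕ} (𝔽 : FiniteField q) where
  open FiniteField 𝔽 renaming (_*_ to _·_)

  ring : CommutativeRing _ _
  ring = record { isCommutativeRing = isCommutativeRing }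

  open CommutativeRing ring using (+-group; *-identityˡ; *-assoc; *-comm; zeroʳ)
  open GroupProperties +-group using (∙-cancelˡ; //-rightDividesˡ; x∙y⁻¹≈ε⇒x≈y)
  open import Algebra.Solver.Ring.NaturalCoefficients.Default
    (CommutativeRing.commutativeSemiring ring)
  open ≡-Reasoning

  -- Equality in a finite field is decidable: compare positions in the enumeration.
  _≟_ : DecidableEquality F
  _≟_ = via-injection (↔⇒↣ (↔-sym enumeration)) Fin._≟_

  nonzero-offset : ∀ {r s} → r ≢ s → ∃ λ u → u ≢ 0# × r ≡ u + s
  nonzero-offset {r} {s} r≢s =
    r + - s , (λ r-s≡0 → r≢s (x∙y⁻¹≈ε⇒x≈y r s r-s≡0)) , sym (//-rightDividesˡ s r)

  ·-cancelˡ : ∀ {x y z} → x ≢ 0# → x · y ≡ x · z → y ≡ z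
  ·-cancelˡ {x} {y} {z} x≢0 xy≡xz with inverse x x≢0
  ... | w , xw≡1 = trans (sym (undo y)) (trans (cong (w ·_) xy≡xz) (undo z))
    where
    undo : ∀ a → w · (x · a) ≡ a
    undo a = begin
      w · (x · a)  ≡⟨ *-assoc w x a ⟨
      (w · x) · a  ≡⟨ cong (_· a) (trans (*-comm w x) xw≡1) ⟩
      1# · a       ≡⟨ *-identityˡ a ⟩
      a            ∎

  square≡0⇒≡0 : ∀ {x} → x · x ≡ 0# → x ≡ 0#
  square≡0⇒≡0 {x} xx≡0 with x ≟ 0#
  ... | yes x≡0 = x≡0
  ... | no x≢0 = ⊥-elim (x≢0 (·-cancelˡ x≢0 (trans xx≡0 (sym (zeroʳ x)))))

  -- If t is a nonsquare then t a² is a square only for a = 0 (else t = (b/a)²).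
  nonsquare-multiple : ∀ {t a b} → IsNonsquare 𝔽 t → b · b ≡ t · (a · a) → a ≡ 0#
  nonsquare-multiple {t} {a} {b} t-nonsquare bb≡taa with a ≟ 0#
  ... | yes a≡0 = a≡0
  ... | no a≢0 with inverse a a≢0
  ...   | w , aw≡1 = ⊥-elim (t-nonsquare (b · w) (begin
          (b · w) · (b · w)          ≡⟨ solve 2 (λ b w → (b :* w) :* (b :* w)
                                          := (b :* b) :* (w :* w)) refl b w ⟩
          (b · b) · (w · w)          ≡⟨ cong (_· (w · w)) bb≡taa ⟩
          (t · (a · a)) · (w · w)    ≡⟨ solve 3 (λ t a w → (t :* (a :* a)) :* (w :* w)
                                          := t :* ((a :* w) :* (a :* w))) refl t a w ⟩
          t · ((a · w) · (a · w))    ≡⟨ cong (λ e → t · (e · e)) aw≡1 ⟩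
          t · (1# · 1#)              ≡⟨ solve 1 (λ t → t :* (con 1 :* con 1) := t) refl t ⟩
          t                          ∎))

  quadratic : F → F → F → F → F
  quadratic A B C r = A · (r · r) + B · r + C

  linear : F → F → F → F
  linear A B r = A · r + B

  linear-offset : ∀ A B u s → linear A B (u + s) ≡ linear A B s + u · A
  linear-offset = solve 4 (λ A B u s → A :* (u :+ s) :+ B := (A :* s :+ B) :+ u :* A) refl

  quadratic-offset : ∀ A B C u s →
    quadratic A B C (u + s) ≡ quadratic A B C s + u · linear A B ((u + s) + s)
  quadratic-offset = solve 5 (λ A B C u s →
    A :* ((u :+ s) :* (u :+ s)) :+ B :* (u :+ s) :+ C
      := (A :* (s :* s) :+ B :* s :+ C) :+ u :* (A :* ((u :+ s) :+ s) :+ B)) refl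

  linear-rigidity : ∀ {A₁ B₁ A₂ B₂ x y} → x ≢ y →
    linear A₁ B₁ x ≡ linear A₂ B₂ x → linear A₁ B₁ y ≡ linear A₂ B₂ y →
    A₁ ≡ A₂ × B₁ ≡ B₂
  linear-rigidity {A₁} {B₁} {A₂} {B₂} {y = y} x≢y at-x at-y with nonzero-offset x≢y
  ... | w , w≢0 , refl = A₁≡A₂ , B₁≡B₂
    where
    A₁≡A₂ : A₁ ≡ A₂
    A₁≡A₂ = ·-cancelˡ w≢0 (∙-cancelˡ (linear A₁ B₁ y) _ _ (begin
      linear A₁ B₁ y + w · A₁  ≡⟨ linear-offset A₁ B₁ w y ⟨
      linear A₁ B₁ (w + y)     ≡⟨ at-x ⟩
      linear A₂ B₂ (w + y)     ≡⟨ linear-offset A₂ B₂ w y ⟩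
      linear A₂ B₂ y + w · A₂  ≡⟨ cong (_+ w · A₂) at-y ⟨
      linear A₁ B₁ y + w · A₂  ∎))
    B₁≡B₂ : B₁ ≡ B₂
    B₁≡B₂ = ∙-cancelˡ (A₁ · y) _ _ (trans at-y (cong (λ A → linear A B₂ y) (sym A₁≡A₂)))

  secant : ∀ {A₁ B₁ C₁ A₂ B₂ C₂ r s} → r ≢ s →
    quadratic A₁ B₁ C₁ r ≡ quadratic A₂ B₂ C₂ r →
    quadratic A₁ B₁ C₁ s ≡ quadratic A₂ B₂ C₂ s →
    linear A₁ B₁ (r + s) ≡ linear A₂ B₂ (r + s)
  secant {A₁} {B₁} {C₁} {A₂} {B₂} {C₂} {s = s} r≢s at-r at-s with nonzero-offset r≢s
  ... | u , u≢0 , refl = ·-cancelˡ u≢0 (∙-cancelˡ (quadratic A₁ B₁ C₁ s) _ _ (begin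
      quadratic A₁ B₁ C₁ s + u · linear A₁ B₁ ((u + s) + s)
        ≡⟨ quadratic-offset A₁ B₁ C₁ u s ⟨
      quadratic A₁ B₁ C₁ (u + s)
        ≡⟨ at-r ⟩
      quadratic A₂ B₂ C₂ (u + s)
        ≡⟨ quadratic-offset A₂ B₂ C₂ u s ⟩
      quadratic A₂ B₂ C₂ s + u · linear A₂ B₂ ((u + s) + s)
        ≡⟨ cong (_+ u · linear A₂ B₂ ((u + s) + s)) at-s ⟨
      quadratic A₁ B₁ C₁ s + u · linear A₂ B₂ ((u + s) + s) ∎))

  record HoldsAtThreePoints (P : F → Set) : Set where
    field
      r₁ r₂ r₃ : F
      r₁≢r₂ : r₁ ≢ r₂
      r₁≢r₃ : r₁ ≢ r₃
      r₂≢r₃ : r₂ ≢ r₃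
      at₁ : P r₁
      at₂ : P r₂
      at₃ : P r₃

  mapThree : ∀ {P P′ : F → Set} → (∀ {r} → P r → P′ r) →
    HoldsAtThreePoints P → HoldsAtThreePoints P′
  mapThree f h = record
    { r₁ = r₁ ; r₂ = r₂ ; r₃ = r₃ ; r₁≢r₂ = r₁≢r₂ ; r₁≢r₃ = r₁≢r₃ ; r₂≢r₃ = r₂≢r₃
    ; at₁ = f at₁ ; at₂ = f at₂ ; at₃ = f at₃ }
    where open HoldsAtThreePoints h

  -- Quadratic rigidity: two quadratics agreeing at three distinct points have
  -- the same r² and r coefficients (their secant slopes agree at r₁ + r₂ ≠ r₁ + r₃).
  quadratic-rigidity : ∀ {A₁ B₁ C₁ A₂ B₂ C₂} →
    HoldsAtThreePoints (λ r → quadratic A₁ B₁ C₁ r ≡ quadratic A₂ B₂ C₂ r) →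
    A₁ ≡ A₂ × B₁ ≡ B₂
  quadratic-rigidity h = linear-rigidity (r₂≢r₃ ∘ ∙-cancelˡ r₁ _ _)
    (secant r₁≢r₂ at₁ at₂) (secant r₁≢r₃ at₁ at₃)
    where open HoldsAtThreePoints h

  along : F → F → F → F
  along u v r = u + r · v

  scaled-square-along : ∀ c u v r →
    c · (along u v r · along u v r) ≡ quadratic (c · (v · v)) (c · (u · v + u · v)) (c · (u · u)) r
  scaled-square-along = solve 4 (λ c u v r → c :* ((u :+ r :* v) :* (u :+ r :* v))
    := (c :* (v :* v)) :* (r :* r) :+ (c :* (u :* v :+ u :* v)) :* r :+ c :* (u :* u)) refl

  zero-factor : ∀ {u v} → HoldsAtThreePoints (λ r → along u v r ≡ 0#) → v ≡ 0#
  zero-factor {u} {v} h = proj₂ (quadratic-rigidity (mapThree as-quadratics h))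
    where
    as-quadratics : ∀ {r} → along u v r ≡ 0# → quadratic 0# v u r ≡ quadratic 0# 0# 0# r
    as-quadratics {r} on = begin
      quadratic 0# v u r    ≡⟨ solve 3 (λ u v r → con 0 :* (r :* r) :+ v :* r :+ u
                                 := u :+ r :* v) refl u v r ⟩
      along u v r           ≡⟨ on ⟩
      0#                    ≡⟨ solve 1 (λ r → con 0
                                 := con 0 :* (r :* r) :+ con 0 :* r :+ con 0) refl r ⟩
      quadratic 0# 0# 0# r  ∎

  module _ {t : F} (t-nonsquare : IsNonsquare 𝔽 t) where

    parabola-factor : ∀ {ux uy vx vy} →
      HoldsAtThreePoints (λ r → along uy vy r ≡ t · (along ux vx r · along ux vx r)) →
      vx ≡ 0# × vy ≡ 0#
    parabola-factor {ux} {uy} {vx} {vy} h = vx≡0 , vy≡0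
      where
      as-quadratics : ∀ {r} → along uy vy r ≡ t · (along ux vx r · along ux vx r) →
        quadratic 0# vy uy r ≡ quadratic (t · (vx · vx)) (t · (ux · vx + ux · vx)) (t · (ux · ux)) r
      as-quadratics {r} on = begin
        quadratic 0# vy uy r  ≡⟨ solve 3 (λ u v r → con 0 :* (r :* r) :+ v :* r :+ u
                                   := u :+ r :* v) refl uy vy r ⟩
        along uy vy r         ≡⟨ on ⟩
        t · (along ux vx r · along ux vx r)
                              ≡⟨ scaled-square-along t ux vx r ⟩
        quadratic (t · (vx · vx)) (t · (ux · vx + ux · vx)) (t · (ux · ux)) r ∎
      coefficients = quadratic-rigidity (mapThree as-quadratics h)
      vx≡0 : vx ≡ 0#
      vx≡0 = nonsquare-multiple t-nonsquare (trans (zeroʳ 0#) (proj₁ coefficients))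
      vy≡0 : vy ≡ 0#
      vy≡0 = begin
        vy                       ≡⟨ proj₂ coefficients ⟩
        t · (ux · vx + ux · vx)  ≡⟨ cong (λ e → t · (ux · e + ux · e)) vx≡0 ⟩
        t · (ux · 0# + ux · 0#)  ≡⟨ solve 2 (λ t u → t :* (u :* con 0 :+ u :* con 0)
                                      := con 0) refl t ux ⟩
        0#                       ∎

    Q-factor : ∀ {ux uy uz vx vy vz} →
      HoldsAtThreePoints (λ r → along uz vz r ≡
        t · (along ux vx r · along ux vx r) + - (along uy vy r · along uy vy r)) →
      vx ≡ 0# × vy ≡ 0# × vz ≡ 0#
    Q-factor {ux} {uy} {uz} {vx} {vy} {vz} h = vx≡0 , vy≡0 , vz≡0
      where
      as-quadratics : ∀ {r} → along uz vz r ≡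
          t · (along ux vx r · along ux vx r) + - (along uy vy r · along uy vy r) →
        quadratic (vy · vy) (vz + (uy · vy + uy · vy)) (uz + uy · uy) r
          ≡ quadratic (t · (vx · vx)) (t · (ux · vx + ux · vx)) (t · (ux · ux)) r
      as-quadratics {r} on = begin
        quadratic (vy · vy) (vz + (uy · vy + uy · vy)) (uz + uy · uy) r
          ≡⟨ solve 5 (λ uy uz vy vz r →
               (vy :* vy) :* (r :* r) :+ (vz :+ (uy :* vy :+ uy :* vy)) :* r :+ (uz :+ uy :* uy)
                 := (uz :+ r :* vz) :+ (uy :+ r :* vy) :* (uy :+ r :* vy)) refl uy uz vy vz r ⟩
        along uz vz r + along uy vy r · along uy vy r
          ≡⟨ cong (_+ along uy vy r · along uy vy r) on ⟩
        (t · (along ux vx r · along ux vx r) + - (along uy vy r · along uy vy r))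
          + along uy vy r · along uy vy r
          ≡⟨ //-rightDividesˡ (along uy vy r · along uy vy r) _ ⟩
        t · (along ux vx r · along ux vx r)
          ≡⟨ scaled-square-along t ux vx r ⟩
        quadratic (t · (vx · vx)) (t · (ux · vx + ux · vx)) (t · (ux · ux)) r ∎
      coefficients = quadratic-rigidity (mapThree as-quadratics h)
      vx≡0 : vx ≡ 0#
      vx≡0 = nonsquare-multiple t-nonsquare (proj₁ coefficients)
      vy≡0 : vy ≡ 0#
      vy≡0 = square≡0⇒≡0 (begin
        vy · vy          ≡⟨ proj₁ coefficients ⟩
        t · (vx · vx)    ≡⟨ cong (λ e → t · (e · e)) vx≡0 ⟩
        t · (0# · 0#)    ≡⟨ solve 1 (λ t → t :* (con 0 :* con 0) := con 0) refl t ⟩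
        0#               ∎)
      vz≡0 : vz ≡ 0#
      vz≡0 = begin
        vz                        ≡⟨ solve 2 (λ vz uy → vz
                                       := vz :+ (uy :* con 0 :+ uy :* con 0)) refl vz uy ⟩
        vz + (uy · 0# + uy · 0#)  ≡⟨ cong (λ e → vz + (uy · e + uy · e)) vy≡0 ⟨
        vz + (uy · vy + uy · vy)  ≡⟨ proj₂ coefficients ⟩
        t · (ux · vx + ux · vx)   ≡⟨ cong (λ e → t · (ux · e + ux · e)) vx≡0 ⟩
        t · (ux · 0# + ux · 0#)   ≡⟨ solve 2 (λ t u → t :* (u :* con 0 :+ u :* con 0)
                                       := con 0) refl t ux ⟩
        0#                        ∎

    point : ∀ {d} → Vec F d → Vec F d → F → Vec F d
    point u v r = _⊕_ 𝔽 u (_⊙_ 𝔽 r v)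

    three-points⇒degenerate : ∀ d {u v : Vec F d} →
      HoldsAtThreePoints (λ r → InP 𝔽 t d (point u v r)) → v ≡ zeroVec 𝔽 d
    three-points⇒degenerate zero {[]} {[]} h = refl
    three-points⇒degenerate (suc zero) {_ ∷ []} {_ ∷ []} h = cong (_∷ []) (zero-factor h)
    three-points⇒degenerate (suc (suc zero)) {_ ∷ _ ∷ []} {_ ∷ _ ∷ []} h =
      let vx≡0 , vy≡0 = parabola-factor h
      in cong₂ (λ x y → x ∷ y ∷ []) vx≡0 vy≡0
    three-points⇒degenerate (suc (suc (suc d))) {_ ∷ _ ∷ _ ∷ _} {_ ∷ _ ∷ _ ∷ _} h =
      let vx≡0 , vy≡0 , vz≡0 = Q-factor (mapThree proj₁ h)
      in cong₂ _∷_ vx≡0 (cong₂ _∷_ vy≡0 (cong₂ _∷_ vz≡0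
           (three-points⇒degenerate d (mapThree proj₂ h))))

    no-three-collinear : ∀ {d} (u v : Vec F d) → ¬ (v ≡ zeroVec 𝔽 d) →
      ∀ (a b c : Vec F d) → InP 𝔽 t d a → InP 𝔽 t d b → InP 𝔽 t d c →
      ¬ (a ≡ b) → ¬ (b ≡ c) → ¬ (a ≡ c) →
      OnLine 𝔽 u v a → OnLine 𝔽 u v b → ¬ OnLine 𝔽 u v c
    no-three-collinear {d} u v v≢0 _ _ _ in-a in-b in-c a≢b b≢c a≢c
      (r₁ , refl) (r₂ , refl) (r₃ , refl) =
        v≢0 (three-points⇒degenerate d (record
          { r₁ = r₁ ; r₂ = r₂ ; r₃ = r₃
          ; r₁≢r₂ = a≢b ∘ cong (point u v) ; r₁≢r₃ = a≢c ∘ cong (point u v)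
          ; r₂≢r₃ = b≢c ∘ cong (point u v)
          ; at₁ = in-a ; at₂ = in-b ; at₃ = in-c }))

  module _ (t : F) where

    fill : ∀ d → Vec F (paramDim d) → Σ (Vec F d) (InP 𝔽 t d)
    fill zero [] = [] , tt
    fill (suc zero) [] = (0# ∷ []) , refl
    fill (suc (suc zero)) (x ∷ []) = (x ∷ t · (x · x) ∷ []) , refl
    fill (suc (suc (suc d))) (x ∷ y ∷ w) =
      (x ∷ y ∷ t · (x · x) + - (y · y) ∷ proj₁ (fill d w)) , refl , proj₂ (fill d w)

    free : ∀ d → Σ (Vec F d) (InP 𝔽 t d) → Vec F (paramDim d)
    free zero _ = []
    free (suc zero) _ = []
    free (suc (suc zero)) ((x ∷ _ ∷ []) , _) = x ∷ []
    free (suc (suc (suc d))) ((x ∷ y ∷ _ ∷ v) , (_ , in-v)) = x ∷ y ∷ free d (v , in-v)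

    fill∘free : ∀ d p → fill d (free d p) ≡ p
    fill∘free zero ([] , tt) = refl
    fill∘free (suc zero) ((_ ∷ []) , refl) = refl
    fill∘free (suc (suc zero)) ((_ ∷ _ ∷ []) , refl) = refl
    fill∘free (suc (suc (suc d))) ((x ∷ y ∷ _ ∷ v) , (refl , in-v)) =
      cong (λ p → (x ∷ y ∷ t · (x · x) + - (y · y) ∷ proj₁ p) , refl , proj₂ p)
           (fill∘free d (v , in-v))

    free∘fill : ∀ d w → free d (fill d w) ≡ w
    free∘fill zero [] = refl
    free∘fill (suc zero) [] = refl
    free∘fill (suc (suc zero)) (_ ∷ []) = refl
    free∘fill (suc (suc (suc d))) (x ∷ y ∷ w) = cong (λ w′ → x ∷ y ∷ w′) (free∘fill d w)

    cardinality : ∀ d → Fin (q ^ ((2 * d) / 3)) ↔ Σ (Vec F d) (InP 𝔽 t d)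
    cardinality d rewrite ⌊2d/3⌋≡paramDim d =
      ↔-trans (Fin^↔Vec enumeration (paramDim d))
              (mk↔ₛ′ (fill d) (free d) (fill∘free d) (free∘fill d))

mainTheorem10 : (p k q : ℕ) → Prime p → ¬ (p ≡ 2) → 1 ≤ k → q ≡ p ^ k →
    (𝔽 : FiniteField q) → (t : FiniteField.F 𝔽) → IsNonsquare 𝔽 t →
    (d : ℕ) → 2 ≤ d →
      (Fin (q ^ ((2 * d) / 3)) ↔ Σ (Vec (FiniteField.F 𝔽) d) (InP 𝔽 t d))
      × (∀ (u v : Vec (FiniteField.F 𝔽) d) → ¬ (v ≡ zeroVec 𝔽 d) →
           ∀ (a b c : Vec (FiniteField.F 𝔽) d) →
           InP 𝔽 t d a → InP 𝔽 t d b → InP 𝔽 t d c →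
           ¬ (a ≡ b) → ¬ (b ≡ c) → ¬ (a ≡ c) →
           OnLine 𝔽 u v a → OnLine 𝔽 u v b → ¬ OnLine 𝔽 u v c)
mainTheorem10 _ _ _ _ _ _ _ 𝔽 t t-nonsquare d _ =
  cardinality t d , no-three-collinear t-nonsquare
  where open FieldFacts 𝔽
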